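{- Let $X$ be a finite poset and let $f\colon X\to\mathbb{R}$ be a Morse function satisfying the Exclusion condition. Then there exists an associated Morse matching $\mathcal{M}_f$ on $X$ with $\mathrm{crit}(\mathcal{M}_f)=\mathrm{crit}(f)$. In particular, if $X$ is a finite two-wide poset and $f\colon X\to\mathbb{R}$ is any Morse function, there exists an associated Morse matching $\mathcal{M}_f$ with $\mathrm{crit}(f)=\mathrm{crit}(\mathcal{M}_f)$.
   Context: $x\prec y$ means $x<y$ with nothing strictly between. A Morse function $f\colon X\to\mathbb{R}$ satisfies, for all $x$, $\#\{y: x\prec y, f(x)\ge f(y)\}\le1$ and $\#\{w: w\prec x, f(w)\ge f(x)\}\le1$; $\mathrm{crit}(f)$ is the set of $x$ for which both sets are empty. Exclusion condition: for every non-critical $x$ exactly one of these two sets is nonempty. The associated matching is $\mathcal{M}_f=\{(x,y): x\prec y, f(x)\ge f(y)\}$. A matching is a set $\mathcal{M}\subseteq X\times X$ with $(x,y)\in\mathcal{M}\Rightarrow x\prec y$ and each element in at most one pair; it is a Morse matching if the directed graph obtained from the Hasse diagram of $X$ (edges $x\to y$ for $x\prec y$) by reversing the edges not in $\mathcal{M}$ has no directed cycles; $\mathrm{crit}(\mathcal{M})$ is the set of elements in no pair of $\mathcal{M}$. $X$ is two-wide if whenever $x\prec z\prec y$ there exists $z'\ne z$ with $x\prec z'\prec y$. -}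

module Defs where

open import Level using (Level; _⊔_; 0ℓ) renaming (suc to lsuc)
open import Data.Nat using (ℕ)
open import Data.Fin using (Fin)
open import Data.Product using (Σ; ∃; _×_; _,_)
open import Data.Sum using (_⊎_)
open import Relation.Nullary using (¬_)
open import Relation.Binary using (Rel; IsPartialOrder; TotalOrder)
open import Relation.Binary.PropositionalEquality using (_≡_; _≢_)
open import Relation.Binary.Construct.Closure.Transitive using (TransClosure)
open import Function.Bundles using (_⇔_)

-- A finite poset: carrier Fin size (any finite set is in bijection with some Fin n),
-- with a partial order whose underlying equality is propositional equality.
record FinitePoset : Set₁ where
  field
    size : ℕ
    _≤_  : Rel (Fin size) 0ℓ
    isPartialOrder : IsPartialOrder _≡_ _≤_

  Elt : Set
  Elt = Fin size

  _<_ : Rel Elt 0ℓ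
  x < y = x ≤ y × x ≢ y

  _≺_ : Rel Elt 0ℓ
  x ≺ y = x < y × (∀ z → ¬ (x < z × z < y))

open FinitePoset public

AtMostOne : ∀ {a ℓ} {A : Set a} → (A → Set ℓ) → Set (a ⊔ ℓ)
AtMostOne P = ∀ a b → P a → P b → a ≡ b

module _ {c ℓ₁ ℓ₂ : Level} (X : FinitePoset) (T : TotalOrder c ℓ₁ ℓ₂)
         (f : Elt X → TotalOrder.Carrier T) where
  private
    open module TO = TotalOrder T using () renaming (_≤_ to _≤ᵀ_)
    _≺X_ = _≺_ X

  Up : Elt X → Elt X → Set ℓ₂
  Up x y = x ≺X y × f y ≤ᵀ f x

  Down : Elt X → Elt X → Set ℓ₂
  Down x w = w ≺X x × f x ≤ᵀ f w

  IsMorseFunction : Set ℓ₂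
  IsMorseFunction = ∀ x → AtMostOne (Up x) × AtMostOne (Down x)

  critF : Elt X → Set ℓ₂
  critF x = (∀ y → ¬ Up x y) × (∀ w → ¬ Down x w)

  Exclusion : Set ℓ₂
  Exclusion = ∀ x → ¬ critF x →
    ((∃ λ y → Up x y) × ¬ (∃ λ w → Down x w)) ⊎
    (¬ (∃ λ y → Up x y) × (∃ λ w → Down x w))

  Mf : Elt X → Elt X → Set ℓ₂
  Mf x y = x ≺X y × f y ≤ᵀ f x

module _ (X : FinitePoset) where
  private
    _≺X_ = _≺_ X

  IsMatching : ∀ {ℓ} → (Elt X → Elt X → Set ℓ) → Set ℓ
  IsMatching M =
    (∀ x y → M x y → x ≺X y) ×
    (∀ a b c d → M a b → M c d →
       (a ≡ c ⊎ a ≡ d ⊎ b ≡ c ⊎ b ≡ d) → (a ≡ c × b ≡ d))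

  -- Hasse diagram with the edges not in M reversed
  ModEdge : ∀ {ℓ} → (Elt X → Elt X → Set ℓ) → Elt X → Elt X → Set ℓ
  ModEdge M u v = (u ≺X v × M u v) ⊎ (v ≺X u × ¬ M v u)

  IsMorseMatching : ∀ {ℓ} → (Elt X → Elt X → Set ℓ) → Set ℓ
  IsMorseMatching M =
    IsMatching M × (∀ x → ¬ TransClosure (ModEdge M) x x)

  critM : ∀ {ℓ} → (Elt X → Elt X → Set ℓ) → Elt X → Set ℓ
  critM M x = (∀ y → ¬ M x y) × (∀ w → ¬ M w x)

  TwoWide : Set
  TwoWide = ∀ x z y → x ≺X z → z ≺X y →
    ∃ λ z′ → z′ ≢ z × x ≺X z′ × z′ ≺X y

-- Along an edge of the Hasse diagram with the edges outside M_f reversed, f never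
-- increases, and it strictly decreases on the reversed edges, since those are exactly
-- the covers x ≺ y with f(x) < f(y).  Hence along a directed path either f strictly
-- decreases or every edge points upwards in X; neither can close up into a cycle, so
-- M_f is acyclic for every f.  The Morse condition gives each element at most one
-- partner above and one below, and Exclusion forbids having both, so M_f is a
-- matching.  In a two-wide poset a chain w ≺ x ≺ y with partners on both sides of x
-- has a second middle element z, which would be a second partner of w or of y;
-- hence there Exclusion is automatic.
module Submission where

open import Defs
open import Level using (Level)
open import Data.Product using (_×_; _,_; proj₁; proj₂)
open import Data.Sum using (_⊎_; inj₁; inj₂)
open import Data.Empty using (⊥-elim)
open import Relation.Nullary using (¬_)
open import Relation.Binary using (TotalOrder)
open import Relation.Binary.PropositionalEquality using (_≡_; refl)
open import Relation.Binary.Construct.Closure.Transitive using (TransClosure; [_]; _∷_)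
import Relation.Binary.Construct.NonStrictToStrict as NonStrictToStrict
open import Function.Bundles using (_⇔_; mk⇔)

module _ {c ℓ₁ ℓ₂ : Level} (X : FinitePoset) (T : TotalOrder c ℓ₁ ℓ₂)
         (f : Elt X → TotalOrder.Carrier T) where

  open TotalOrder T using (total)
    renaming (_≤_ to _≤ᵀ_; refl to ≤ᵀ-refl; trans to ≤ᵀ-trans)
  open NonStrictToStrict _≡_ (_≤_ X) using (<-trans)

  private
    M : Elt X → Elt X → Set ℓ₂
    M = Mf X T f

  UpDownExclusive : Set ℓ₂
  UpDownExclusive = ∀ {x y w} → Up X T f x y → ¬ Down X T f x w

  exclusion⇒upDownExclusive : Exclusion X T f → UpDownExclusive
  exclusion⇒upDownExclusive excl {x} {y} {w} up down
    with excl x (λ crit → proj₁ crit y up)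
  ... | inj₁ (_ , noDown) = noDown (w , down)
  ... | inj₂ (noUp , _)   = noUp (y , up)

  twoWide⇒upDownExclusive : TwoWide X → IsMorseFunction X T f → UpDownExclusive
  twoWide⇒upDownExclusive twoWide morse {x} {y} {w} (x≺y , fy≤fx) (w≺x , fx≤fw)
    with twoWide w x y w≺x x≺y
  ... | z , z≢x , w≺z , z≺y with total (f z) (f w)
  ... | inj₁ fz≤fw = z≢x (proj₁ (morse w) z x (w≺z , fz≤fw) (w≺x , fx≤fw))
  ... | inj₂ fw≤fz =
    z≢x (proj₂ (morse y) z x (z≺y , ≤ᵀ-trans fy≤fx (≤ᵀ-trans fx≤fw fw≤fz)) (x≺y , fy≤fx))

  Mf-isMatching : IsMorseFunction X T f → UpDownExclusive → IsMatching X M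
  Mf-isMatching morse exclusive = (λ _ _ → proj₁) , disjoint
    where
    disjoint : ∀ a b c d → M a b → M c d →
               (a ≡ c ⊎ a ≡ d ⊎ b ≡ c ⊎ b ≡ d) → (a ≡ c × b ≡ d)
    disjoint a b .a d ab ad (inj₁ refl)                = refl , proj₁ (morse a) b d ab ad
    disjoint a b c .a ab ca (inj₂ (inj₁ refl))         = ⊥-elim (exclusive ab ca)
    disjoint a b .b d ab bd (inj₂ (inj₂ (inj₁ refl)))  = ⊥-elim (exclusive bd ab)
    disjoint a b c .b ab cb (inj₂ (inj₂ (inj₂ refl)))  = proj₂ (morse b) a c ab cb , refl

  Descent : Elt X → Elt X → Set ℓ₂
  Descent u v = f v ≤ᵀ f u × (_<_ X u v ⊎ ¬ f u ≤ᵀ f v)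

  descent-trans : ∀ {u v w} → Descent u v → Descent v w → Descent u w
  descent-trans {u} {v} {w} (fv≤fu , u<v⊎fu≰fv) (fw≤fv , v<w⊎fv≰fw) =
    ≤ᵀ-trans fw≤fv fv≤fu , strict u<v⊎fu≰fv v<w⊎fv≰fw
    where
    strict : _<_ X u v ⊎ ¬ f u ≤ᵀ f v → _<_ X v w ⊎ ¬ f v ≤ᵀ f w →
             _<_ X u w ⊎ ¬ f u ≤ᵀ f w
    strict (inj₁ u<v)   (inj₁ v<w)   = inj₁ (<-trans (isPartialOrder X) u<v v<w)
    strict (inj₂ fu≰fv) _            = inj₂ (λ fu≤fw → fu≰fv (≤ᵀ-trans fu≤fw fw≤fv))
    strict (inj₁ _)     (inj₂ fv≰fw) = inj₂ (λ fu≤fw → fv≰fw (≤ᵀ-trans fv≤fu fu≤fw))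

  modEdge⇒descent : ∀ {u v} → ModEdge X M u v → Descent u v
  modEdge⇒descent (inj₁ ((u<v , _) , (_ , fv≤fu))) = fv≤fu , inj₁ u<v
  modEdge⇒descent {u} {v} (inj₂ (v≺u , v↛u)) with total (f u) (f v)
  ... | inj₁ fu≤fv = ⊥-elim (v↛u (v≺u , fu≤fv))
  ... | inj₂ fv≤fu = fv≤fu , inj₂ (λ fu≤fv → v↛u (v≺u , fu≤fv))

  modPath⇒descent : ∀ {u v} → TransClosure (ModEdge X M) u v → Descent u v
  modPath⇒descent [ e ]   = modEdge⇒descent e
  modPath⇒descent (e ∷ p) = descent-trans (modEdge⇒descent e) (modPath⇒descent p)

  Mf-acyclic : ∀ x → ¬ TransClosure (ModEdge X M) x x
  Mf-acyclic x cycle with modPath⇒descent cycle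
  ... | _ , inj₁ (_ , x≢x) = x≢x refl
  ... | _ , inj₂ fx≰fx     = fx≰fx ≤ᵀ-refl

  Mf-isMorseMatching : IsMorseFunction X T f → UpDownExclusive → IsMorseMatching X M
  Mf-isMorseMatching morse exclusive = Mf-isMatching morse exclusive , Mf-acyclic

  critM-Mf⇔critF : ∀ x → critM X M x ⇔ critF X T f x
  critM-Mf⇔critF x = mk⇔ (λ crit → crit) (λ crit → crit)

theorem3p14 : ∀ {c ℓ₁ ℓ₂ : Level} →
    ((X : FinitePoset) (T : TotalOrder c ℓ₁ ℓ₂)
       (f : Elt X → TotalOrder.Carrier T) →
       IsMorseFunction X T f → Exclusion X T f →
       IsMorseMatching X (Mf X T f) × (∀ x → critM X (Mf X T f) x ⇔ critF X T f x))
    ×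
    ((X : FinitePoset) (T : TotalOrder c ℓ₁ ℓ₂)
       (f : Elt X → TotalOrder.Carrier T) →
       TwoWide X → IsMorseFunction X T f →
       IsMorseMatching X (Mf X T f) × (∀ x → critM X (Mf X T f) x ⇔ critF X T f x))
theorem3p14 =
  (λ X T f morse excl →
     Mf-isMorseMatching X T f morse (exclusion⇒upDownExclusive X T f excl)
     , critM-Mf⇔critF X T f)
  ,
  (λ X T f twoWide morse →
     Mf-isMorseMatching X T f morse (twoWide⇒upDownExclusive X T f twoWide morse)
     , critM-Mf⇔critF X T f)
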